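{- There is a function $\varepsilon(n)$ with $\varepsilon(n)\to 0$ as $n\to\infty$ such that for every positive integer $n$ there exists a cobipartite graph $G$ on $n$ vertices with $\mathrm{lcc}(G)>\frac{1}{4}(1-\varepsilon(n))\frac{n}{\log n}$.
   Context: A graph is cobipartite if its complement is bipartite. A clique covering of a graph $G$ is a family $\mathcal{C}$ of cliques of $G$ such that every edge of $G$ is contained in at least one clique of $\mathcal{C}$; it is a $k$-clique covering if every vertex belongs to at most $k$ cliques of $\mathcal{C}$. $\mathrm{lcc}(G)$ is the smallest $k$ such that $G$ admits a $k$-clique covering. Logarithms are base $2$. -}

module Defs where

open import Data.Bool using (Bool; true; false; T)
open import Data.Nat using (ℕ; zero; suc; _*_; _^_; _<_; _≤_)
open import Data.Fin using (Fin)
open import Data.List using (List; length; filterᵇ)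
open import Data.List.Membership.Propositional using (_∈_)
open import Data.List.Relation.Unary.All using (All)
open import Data.Product using (Σ; ∃; _×_)
open import Data.Unit using (⊤)
open import Data.Integer as ℤ using (ℤ; +_; -[1+_])
open import Data.Rational as ℚ using (ℚ; ↥_; ↧_; ↧ₙ_; 0ℚ)
open import Relation.Binary.PropositionalEquality using (_≡_; _≢_)
open import Relation.Nullary using (¬_)

record Graph (n : ℕ) : Set where
  field
    adj   : Fin n → Fin n → Bool
    sym   : ∀ u v → adj u v ≡ adj v u
    irref : ∀ v → adj v v ≡ false
open Graph public

Adj : ∀ {n} → Graph n → Fin n → Fin n → Set
Adj G u v = T (adj G u v)

-- Complement of G is bipartite: a 2-colouring with every edge of the
-- complement (distinct non-adjacent u v) bichromatic.
IsCobipartite : ∀ {n} → Graph n → Set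
IsCobipartite {n} G =
  Σ (Fin n → Bool) λ c → ∀ u v → u ≢ v → ¬ Adj G u v → c u ≢ c v

VSet : ℕ → Set
VSet n = Fin n → Bool

IsClique : ∀ {n} → Graph n → VSet n → Set
IsClique G C = ∀ u v → T (C u) → T (C v) → u ≢ v → Adj G u v

IsCliqueCovering : ∀ {n} → Graph n → List (VSet n) → Set
IsCliqueCovering {n} G 𝒞 =
  All (IsClique G) 𝒞 ×
  (∀ u v → Adj G u v → ∃ λ C → C ∈ 𝒞 × T (C u) × T (C v))

load : ∀ {n} → List (VSet n) → Fin n → ℕ
load 𝒞 v = length (filterᵇ (λ C → C v) 𝒞)

IsKCliqueCovering : ∀ {n} → Graph n → ℕ → List (VSet n) → Set
IsKCliqueCovering {n} G k 𝒞 = IsCliqueCovering G 𝒞 × (∀ v → load 𝒞 v ≤ k)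

HasKCliqueCovering : ∀ {n} → Graph n → ℕ → Set
HasKCliqueCovering G k = ∃ λ 𝒞 → IsKCliqueCovering G k 𝒞

IsLcc : ∀ {n} → Graph n → ℕ → Set
IsLcc G l = HasKCliqueCovering G l × (∀ k → HasKCliqueCovering G k → l ≤ k)

-- LccBound n l e  encodes the real inequality
--     4 · l · log₂ n  >  (1 - e) · n        (n ≥ 1),
-- i.e. l > (1/4)(1 - e) n / log₂ n for n ≥ 2, without real numbers.
-- Writing e = p/q (q > 0) and k = q - p, it is equivalent to
--     n ^ (4 q l) > 2 ^ (k n)
-- (real powers); when k < 0 the right side is < 1 ≤ left side.
LccBound : ℕ → ℕ → ℚ → Set
LccBound n l e with (↧ e) ℤ.- (↥ e)
... | + k      = 2 ^ (k * n) < n ^ (4 * ↧ₙ e * l)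
... | -[1+ _ ] = ⊤

TendsToZero : (ℕ → ℚ) → Set
TendsToZero ε = ∀ (δ : ℚ) → 0ℚ ℚ.< δ → ∃ λ N → ∀ n → N ≤ n → ℚ.∣ ε n ∣ ℚ.< δ

-- A K-clique covering of a graph on n vertices can be recorded as an incidence matrix of
-- vertices against cliques with at most K ones per row; after discarding empty cliques it has
-- at most K n columns, and the graph is recovered from it (u ~ v iff rows u and v meet). Hence
-- at most S^n graphs have lcc ≤ K, where S = ∑_{i ≤ K} (Kn choose i) ≤ (4(n + 1))^K. On the
-- other hand the cobipartite graphs made of two cliques of sizes ⌊n/2⌋ and ⌈n/2⌉ are determined
-- by their cross edges, so there are 2^⌊n²/4⌋ of them. For K ≈ n / 4 log₂ n the first count is
-- smaller, so one of these graphs has lcc > K. Enumerating the matrices also decides whether a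
-- K-clique covering exists, which makes lcc computable.

module Submission where

open import Defs renaming (sym to adj-sym)
open import Data.Bool using (Bool; true; false; T; not; _∧_; _∨_; if_then_else_)
open import Data.Bool.Properties using (T-∧; T-∨; T-not-≡)
open import Data.Fin using (Fin; zero; suc; splitAt; _↑ˡ_; _↑ʳ_; finToFun; funToFin; combine; remQuot; _≟_)
open import Data.Fin.Properties using (any?; all?; splitAt-↑ˡ; splitAt-↑ʳ; finToFun-funToFin; remQuot-combine;
  combine-remQuot; funToFin-finToFin; injective⇒≤; 2↔Bool)
import Data.Integer as ℤ
open import Data.List using (List; []; _∷_; length; filter; tabulate)
open import Data.List.Properties using (length-filter; length-tabulate)
open import Data.List.Membership.Propositional using (_∈_)
open import Data.List.Membership.Propositional.Properties using (∈-filter⁺; ∈-filter⁻; ∈-tabulate⁺)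
open import Data.List.Relation.Unary.All as All using (All; []; _∷_)
open import Data.List.Relation.Unary.All.Properties using (all-filter; tabulate⁺)
open import Data.List.Relation.Unary.Any using (here; there)
open import Data.Nat using (ℕ; zero; suc; _+_; _*_; _^_; _!; _≤_; _<_; z≤n; s≤s; s≤s⁻¹; NonZero; _<?_)
open import Data.Nat.DivMod using (_/_; _%_; m≡m%n+[m/n]*n; m%n<n; m/n*n≤m; m*n/n≡m; /-monoˡ-≤)
open import Data.Nat.Properties hiding (_≟_)
open import Data.Nat.Coprimality using (1-coprimeTo)
open import Data.Nat.Tactic.RingSolver using (solve-∀)
open import Algebra.Properties.CommutativeMonoid.Sum +-0-commutativeMonoid
  using (sum; sum-syntax; ∑-distrib-+; sum-cong-≋)
open import Data.Product using (Σ; ∃; ∃₂; _×_; _,_; proj₁; proj₂)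
open import Data.Rational as ℚ using (ℚ; mkℚ)
open import Data.Sum using (_⊎_; inj₁; inj₂; [_,_]′)
open import Data.Unit using (tt)
import Data.Vec.Functional as Vec
open import Function using (_∘_; _⇔_; mk⇔; Equivalence; Inverse; const)
open import Relation.Nullary using (Dec; yes; no; ¬_; does; contradiction)
open import Relation.Nullary.Decidable
  using (T?; ¬?; ⌊_⌋; fromWitness; _×-dec_; _→-dec_; map′; does-⇔; dec-true; dec-false; decidable-stable)
open import Relation.Binary.PropositionalEquality

-- Powers and factorials

^-distribʳ-* : ∀ m n k → (m * n) ^ k ≡ m ^ k * n ^ k
^-distribʳ-* m n zero    = refl
^-distribʳ-* m n (suc k) = begin
  m * n * (m * n) ^ k      ≡⟨ cong (m * n *_) (^-distribʳ-* m n k) ⟩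
  m * n * (m ^ k * n ^ k)  ≡⟨ interchange m n (m ^ k) (n ^ k) ⟩
  m ^ suc k * n ^ suc k    ∎
  where
  open ≡-Reasoning
  interchange : ∀ a b c d → a * b * (c * d) ≡ a * c * (b * d)
  interchange = solve-∀

n!≤n^n : ∀ n → n ! ≤ n ^ n
n!≤n^n zero    = ≤-refl
n!≤n^n (suc n) = *-monoʳ-≤ (suc n) (≤-trans (n!≤n^n n) (^-monoˡ-≤ n (n≤1+n n)))

bernoulli : ∀ y j → y ^ suc j + suc j * y ^ j ≤ suc y ^ suc j
bernoulli y zero    = ≤-reflexive (identity y)
  where
  identity : ∀ y → y * 1 + 1 * 1 ≡ suc y * 1
  identity = solve-∀
bernoulli y (suc j) = begin
  y * (y * B) + (2 + j) * (y * B)                ≤⟨ m≤m+n _ ((1 + j) * B) ⟩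
  y * (y * B) + (2 + j) * (y * B) + (1 + j) * B  ≡⟨ identity y B j ⟩
  suc y * (y * B + suc j * B)                    ≤⟨ *-monoʳ-≤ (suc y) (bernoulli y j) ⟩
  suc y * suc y ^ suc j                          ∎
  where
  open ≤-Reasoning
  B = y ^ j
  identity : ∀ y B j → y * (y * B) + (2 + j) * (y * B) + (1 + j) * B ≡ suc y * (y * B + suc j * B)
  identity = solve-∀

bernoulli-upper : ∀ y j → suc y ^ suc j ≤ y ^ suc j + suc j * suc y ^ j
bernoulli-upper y zero    = ≤-reflexive (identity y)
  where
  identity : ∀ y → suc y * 1 ≡ y * 1 + 1 * 1
  identity = solve-∀
bernoulli-upper y (suc j) = begin
  suc y * suc y ^ suc j                             ≤⟨ *-monoʳ-≤ (suc y) (bernoulli-upper y j) ⟩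
  suc y * (y * B + suc j * Q)                       ≡⟨ expand y B j Q ⟩
  y * B + y * (y * B) + suc j * (suc y * Q)         ≤⟨ +-monoˡ-≤ _ (+-monoˡ-≤ _ yB≤Q′) ⟩
  suc y * Q + y * (y * B) + suc j * (suc y * Q)     ≡⟨ collect y B j Q ⟩
  y * (y * B) + (2 + j) * (suc y * Q)               ∎
  where
  open ≤-Reasoning
  B = y ^ j
  Q = suc y ^ j
  yB≤Q′ : y * B ≤ suc y * Q
  yB≤Q′ = *-mono-≤ (n≤1+n y) (^-monoˡ-≤ j (n≤1+n y))
  expand : ∀ y B j Q → suc y * (y * B + suc j * Q) ≡ y * B + y * (y * B) + suc j * (suc y * Q)
  expand = solve-∀
  collect : ∀ y B j Q → suc y * Q + y * (y * B) + suc j * (suc y * Q) ≡ y * (y * B) + (2 + j) * (suc y * Q)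
  collect = solve-∀

suc-^≤2*^ : ∀ y j → 2 * j ≤ suc y → suc y ^ j ≤ 2 * y ^ j
suc-^≤2*^ y zero    _      = s≤s z≤n
suc-^≤2*^ y (suc i) 2j≤1+y = +-cancelʳ-≤ Z Z (2 * Y) (begin
  Z + Z                           ≡⟨ +-*-2 Z ⟩
  2 * Z                           ≤⟨ *-monoʳ-≤ 2 (bernoulli-upper y i) ⟩
  2 * (Y + suc i * suc y ^ i)     ≡⟨ distrib Y i (suc y ^ i) ⟩
  2 * Y + 2 * suc i * suc y ^ i   ≤⟨ +-monoʳ-≤ (2 * Y) (*-monoˡ-≤ (suc y ^ i) 2j≤1+y) ⟩
  2 * Y + Z                       ∎)
  where
  open ≤-Reasoning
  Z = suc y ^ suc i
  Y = y ^ suc i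
  +-*-2 : ∀ Z → Z + Z ≡ 2 * Z
  +-*-2 = solve-∀
  distrib : ∀ Y i W → 2 * (Y + suc i * W) ≡ 2 * Y + 2 * suc i * W
  distrib = solve-∀

-- (1 + 1/n)ⁿ ≤ (1 + 1/2n)²ⁿ ≤ 2², the second step by suc-^≤2*^.
suc-n^n≤4*n^n : ∀ n → suc n ^ n ≤ 4 * n ^ n
suc-n^n≤4*n^n zero      = s≤s z≤n
suc-n^n≤4*n^n n@(suc k) =
  *-cancelʳ-≤ (suc n ^ n) (4 * n ^ n) (W * W) {{m*n≢0 W W {{W≢0}} {{W≢0}}}} (begin
    suc n ^ n * (W * W)                     ≡⟨ cong (suc n ^ n *_) (^-distribʳ-* t t n) ⟨
    suc n ^ n * (t * t) ^ n                 ≡⟨ ^-distribʳ-* (suc n) (t * t) n ⟨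
    (suc n * (t * t)) ^ n                   ≤⟨ ^-monoˡ-≤ n (≤-trans (m≤m+n _ n) (≤-reflexive (square-gap n))) ⟩
    (n * (suc t * suc t)) ^ n               ≡⟨ ^-distribʳ-* n (suc t * suc t) n ⟩
    n ^ n * (suc t * suc t) ^ n             ≡⟨ cong (n ^ n *_) (^-distribʳ-* (suc t) (suc t) n) ⟩
    n ^ n * (suc t ^ n * suc t ^ n)         ≤⟨ *-monoʳ-≤ (n ^ n) (*-mono-≤ [1+t]^n≤2W [1+t]^n≤2W) ⟩
    n ^ n * (2 * W * (2 * W))               ≡⟨ regroup (n ^ n) W ⟩
    4 * n ^ n * (W * W)                     ∎)
  where
  open ≤-Reasoning
  t = 2 * n
  W = t ^ n
  instance
    W≢0 : NonZero W
    W≢0 = m^n≢0 t n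
  [1+t]^n≤2W : suc t ^ n ≤ 2 * W
  [1+t]^n≤2W = suc-^≤2*^ t n (n≤1+n t)
  square-gap : ∀ n → suc n * (2 * n * (2 * n)) + n ≡ n * (suc (2 * n) * suc (2 * n))
  square-gap = solve-∀
  regroup : ∀ A W → A * (2 * W * (2 * W)) ≡ 4 * A * (W * W)
  regroup = solve-∀

n^n≤4^n*n! : ∀ n → n ^ n ≤ 4 ^ n * n !
n^n≤4^n*n! zero    = ≤-refl
n^n≤4^n*n! (suc n) = begin
  suc n * suc n ^ n            ≤⟨ *-monoʳ-≤ (suc n) (suc-n^n≤4*n^n n) ⟩
  suc n * (4 * n ^ n)          ≤⟨ *-monoʳ-≤ (suc n) (*-monoʳ-≤ 4 (n^n≤4^n*n! n)) ⟩
  suc n * (4 * (4 ^ n * n !))  ≡⟨ regroup (suc n) (4 ^ n) (n !) ⟩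
  4 * 4 ^ n * (suc n * n !)    ∎
  where
  open ≤-Reasoning
  regroup : ∀ k a f → k * (4 * (a * f)) ≡ 4 * a * (k * f)
  regroup = solve-∀

-- #subsets≤ N K = ∑_{i ≤ K} (N choose i), by Pascal's rule.
#subsets≤ : ℕ → ℕ → ℕ
#subsets≤ _       zero    = 1
#subsets≤ zero    (suc K) = 1
#subsets≤ (suc N) (suc K) = #subsets≤ N (suc K) + #subsets≤ N K

#subsets≤*!≤ : ∀ N K → #subsets≤ N K * K ! ≤ (N + K) ^ K
#subsets≤*!≤ N       zero    = ≤-refl
#subsets≤*!≤ zero    (suc K) = ≤-trans (≤-reflexive (*-identityˡ _)) (n!≤n^n (suc K))
#subsets≤*!≤ (suc N) (suc K) = begin
  (#subsets≤ N (suc K) + #subsets≤ N K) * (suc K * K !)      ≡⟨ distrib (#subsets≤ N (suc K)) (#subsets≤ N K) K (K !) ⟩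
  #subsets≤ N (suc K) * suc K ! + suc K * (#subsets≤ N K * K !)
    ≤⟨ +-mono-≤ (#subsets≤*!≤ N (suc K)) (*-monoʳ-≤ (suc K) (#subsets≤*!≤ N K)) ⟩
  y ^ suc K + suc K * (N + K) ^ K                            ≤⟨ +-monoʳ-≤ (y ^ suc K) (*-monoʳ-≤ (suc K) (^-monoˡ-≤ K N+K≤y)) ⟩
  y ^ suc K + suc K * y ^ K                                  ≤⟨ bernoulli y K ⟩
  suc y ^ suc K                                              ∎
  where
  open ≤-Reasoning
  y = N + suc K
  N+K≤y : N + K ≤ y
  N+K≤y = +-monoʳ-≤ N (n≤1+n K)
  distrib : ∀ a b k f → (a + b) * (suc k * f) ≡ a * (suc k * f) + suc k * (b * f)
  distrib = solve-∀

#subsets≤-bound : ∀ K n → #subsets≤ (K * n) K ≤ (4 * suc n) ^ K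
#subsets≤-bound K n = *-cancelʳ-≤ _ _ (K !) {{K !≢0}} (begin
  #subsets≤ (K * n) K * K !   ≤⟨ #subsets≤*!≤ (K * n) K ⟩
  (K * n + K) ^ K             ≡⟨ cong (_^ K) (factor K n) ⟩
  (K * suc n) ^ K             ≡⟨ ^-distribʳ-* K (suc n) K ⟩
  K ^ K * suc n ^ K           ≤⟨ *-monoˡ-≤ (suc n ^ K) (n^n≤4^n*n! K) ⟩
  4 ^ K * K ! * suc n ^ K     ≡⟨ swap (4 ^ K) (K !) (suc n ^ K) ⟩
  4 ^ K * suc n ^ K * K !     ≡⟨ cong (_* K !) (^-distribʳ-* 4 (suc n) K) ⟨
  (4 * suc n) ^ K * K !       ∎)
  where
  open ≤-Reasoning
  factor : ∀ K n → K * n + K ≡ K * suc n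
  factor = solve-∀
  swap : ∀ a b c → a * b * c ≡ a * c * b
  swap = solve-∀

count : ∀ {N} → (Fin N → Bool) → ℕ
count {N} r = ∑[ i < N ] (if r i then 1 else 0)

count-false : ∀ N → count {N} (const false) ≡ 0
count-false zero    = refl
count-false (suc N) = count-false N

count-pos : ∀ {N} (r : Fin N → Bool) i → T (r i) → 1 ≤ count r
count-pos r zero    ri with r zero
... | true = s≤s z≤n
count-pos r (suc i) ri = ≤-trans (count-pos (r ∘ suc) i ri) (m≤n+m _ _)

count≤0⇒false : ∀ {N} (r : Fin N → Bool) → count r ≤ 0 → ∀ i → r i ≡ false
count≤0⇒false r r≤0 i with r i in eq
... | true  = contradiction (≤-trans (count-pos r i (subst T (sym eq) _)) r≤0) λ ()
... | false = refl

sum≤* : ∀ {n} (f : Fin n → ℕ) {K} → (∀ i → f i ≤ K) → sum f ≤ n * K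
sum≤* {zero}  f f≤K = z≤n
sum≤* {suc n} f f≤K = +-mono-≤ (f≤K zero) (sum≤* (f ∘ suc) (f≤K ∘ suc))

load-∷ : ∀ {n} C (𝒞 : List (VSet n)) v → load (C ∷ 𝒞) v ≡ (if C v then 1 else 0) + load 𝒞 v
load-∷ C 𝒞 v with C v
... | true  = refl
... | false = refl

load-tabulate : ∀ {n N} (f : Fin N → VSet n) v → load (tabulate f) v ≡ count (λ i → f i v)
load-tabulate {N = zero}  f v = refl
load-tabulate {N = suc N} f v = trans (load-∷ (f zero) _ v) (cong (_ +_) (load-tabulate (f ∘ suc) v))

load-filter : ∀ {n p} {P : VSet n → Set p} (P? : ∀ C → Dec (P C)) 𝒞 v → load (filter P? 𝒞) v ≤ load 𝒞 v
load-filter P? []       v = z≤n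
load-filter P? (C ∷ 𝒞) v with does (P? C)
... | true  = begin
  load (C ∷ filter P? 𝒞) v                   ≡⟨ load-∷ C _ v ⟩
  (if C v then 1 else 0) + load (filter P? 𝒞) v  ≤⟨ +-monoʳ-≤ _ (load-filter P? 𝒞 v) ⟩
  (if C v then 1 else 0) + load 𝒞 v          ≡⟨ load-∷ C 𝒞 v ⟨
  load (C ∷ 𝒞) v                             ∎
  where open ≤-Reasoning
... | false = ≤-trans (load-filter P? 𝒞 v) (≤-trans (m≤n+m _ _) (≤-reflexive (sym (load-∷ C 𝒞 v))))

Inhabited : ∀ {n} → VSet n → Set
Inhabited C = ∃ λ v → T (C v)

length≤∑load : ∀ {n} (𝒞 : List (VSet n)) → All Inhabited 𝒞 → length 𝒞 ≤ ∑[ v < n ] load 𝒞 v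
length≤∑load []       []                = z≤n
length≤∑load {n} (C ∷ 𝒞) ((v , Cv) ∷ inh) = begin
  1 + length 𝒞                                        ≤⟨ +-mono-≤ (count-pos C v Cv) (length≤∑load 𝒞 inh) ⟩
  count C + ∑[ u < n ] load 𝒞 u                       ≡⟨ ∑-distrib-+ (λ u → if C u then 1 else 0) (load 𝒞) ⟨
  ∑[ u < n ] ((if C u then 1 else 0) + load 𝒞 u)      ≡⟨ sum-cong-≋ (load-∷ C 𝒞) ⟨
  ∑[ u < n ] load (C ∷ 𝒞) u                           ∎
  where open ≤-Reasoning

-- Codes of clique coverings

Meet : ∀ {N} → (Fin N → Bool) → (Fin N → Bool) → Set
Meet r s = ∃ λ i → T (r i) × T (s i)

meet? : ∀ {N} (r s : Fin N → Bool) → Dec (Meet r s)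
meet? r s = any? λ i → T? (r i) ×-dec T? (s i)

-- A code of width N for a graph on Fin n is an incidence matrix c : Fin n → Fin N → Bool
-- of vertices against cliques.
Sparse : ∀ {n N} → ℕ → (Fin n → Fin N → Bool) → Set
Sparse K c = ∀ v → count (c v) ≤ K

Encodes : ∀ {n N} → Graph n → (Fin n → Fin N → Bool) → Set
Encodes G c = ∀ u v → u ≢ v → Adj G u v ⇔ Meet (c u) (c v)

_⇔?_ : ∀ {A B : Set} → Dec A → Dec B → Dec (A ⇔ B)
a? ⇔? b? = map′ (λ (f , g) → mk⇔ f g) (λ e → Equivalence.to e , Equivalence.from e)
                ((a? →-dec b?) ×-dec (b? →-dec a?))

encodes? : ∀ {n N} (G : Graph n) (c : Fin n → Fin N → Bool) → Dec (Encodes G c)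
encodes? G c = all? λ u → all? λ v → ¬? (u ≟ v) →-dec (T? (adj G u v) ⇔? meet? (c u) (c v))

Encodes-resp : ∀ {n N} (G : Graph n) {c c′ : Fin n → Fin N → Bool} →
               (∀ v i → c v i ≡ c′ v i) → Encodes G c → Encodes G c′
Encodes-resp G c≗c′ enc u v u≢v = mk⇔
  (λ a → let (i , cu , cv) = Equivalence.to (enc u v u≢v) a
         in i , subst T (c≗c′ u i) cu , subst T (c≗c′ v i) cv)
  (λ (i , cu , cv) → Equivalence.from (enc u v u≢v)
                       (i , subst T (sym (c≗c′ u i)) cu , subst T (sym (c≗c′ v i)) cv))

¬Adj-refl : ∀ {n} (G : Graph n) u → ¬ Adj G u u
¬Adj-refl G u a = subst T (irref G u) a

encodes⇒covering : ∀ {n N K} (G : Graph n) (c : Fin n → Fin N → Bool) →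
                   Sparse K c → Encodes G c → HasKCliqueCovering G K
encodes⇒covering {n} {N} {K} G c sparse enc = tabulate column , (cliques , covers) , loads
  where
  column : Fin N → VSet n
  column i v = c v i
  cliques : All (IsClique G) (tabulate column)
  cliques = tabulate⁺ λ i u v cu cv u≢v → Equivalence.from (enc u v u≢v) (i , cu , cv)
  covers : ∀ u v → Adj G u v → ∃ λ C → C ∈ tabulate column × T (C u) × T (C v)
  covers u v a with u ≟ v
  ... | yes refl = contradiction a (¬Adj-refl G u)
  ... | no u≢v   = let (i , cu , cv) = Equivalence.to (enc u v u≢v) a
                   in column i , ∈-tabulate⁺ i , cu , cv
  loads : ∀ v → load (tabulate column) v ≤ K
  loads v = subst (_≤ K) (sym (load-tabulate column v)) (sparse v)

column : ∀ {n} → List (VSet n) → (N : ℕ) → Fin N → VSet n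
column []       N       i       = const false
column (C ∷ 𝒞) (suc N) zero    = C
column (C ∷ 𝒞) (suc N) (suc i) = column 𝒞 N i

count-column : ∀ {n} (𝒞 : List (VSet n)) N v → length 𝒞 ≤ N → count (λ i → column 𝒞 N i v) ≡ load 𝒞 v
count-column []       N       v _     = count-false N
count-column (C ∷ 𝒞) (suc N) v 𝒞≤N = trans (cong (_ +_) (count-column 𝒞 N v (s≤s⁻¹ 𝒞≤N))) (sym (load-∷ C 𝒞 v))

column-surjective : ∀ {n} (𝒞 : List (VSet n)) N {C} → length 𝒞 ≤ N → C ∈ 𝒞 → ∃ λ i → column 𝒞 N i ≡ C
column-surjective (D ∷ 𝒞) (suc N) 𝒞≤N (here refl) = zero , refl
column-surjective (D ∷ 𝒞) (suc N) 𝒞≤N (there C∈) =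
  let (i , eq) = column-surjective 𝒞 N (s≤s⁻¹ 𝒞≤N) C∈ in suc i , eq

column-∈ : ∀ {n} (𝒞 : List (VSet n)) N i u → T (column 𝒞 N i u) → column 𝒞 N i ∈ 𝒞
column-∈ (C ∷ 𝒞) (suc N) zero    u _ = here refl
column-∈ (C ∷ 𝒞) (suc N) (suc i) u t = there (column-∈ 𝒞 N i u t)

-- Empty cliques are discarded first, so that the remaining ones fit into K * n columns.
covering⇒encodes : ∀ {n K} (G : Graph n) → HasKCliqueCovering G K →
                   Σ (Fin n → Fin (K * n) → Bool) λ c → Sparse K c × Encodes G c
covering⇒encodes {n} {K} G (𝒞 , (cliques , covers) , loads) = c , sparse , encodes
  where
  inhabited? : ∀ C → Dec (Inhabited C)
  inhabited? C = any? (T? ∘ C)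
  𝒞⁺ = filter inhabited? 𝒞
  loads⁺ : ∀ v → load 𝒞⁺ v ≤ K
  loads⁺ v = ≤-trans (load-filter inhabited? 𝒞 v) (loads v)
  fits : length 𝒞⁺ ≤ K * n
  fits = begin
    length 𝒞⁺             ≤⟨ length≤∑load 𝒞⁺ (all-filter inhabited? 𝒞) ⟩
    ∑[ v < n ] load 𝒞⁺ v  ≤⟨ sum≤* (load 𝒞⁺) loads⁺ ⟩
    n * K                 ≡⟨ *-comm n K ⟩
    K * n                 ∎
    where open ≤-Reasoning
  c : Fin n → Fin (K * n) → Bool
  c v i = column 𝒞⁺ (K * n) i v
  sparse : Sparse K c
  sparse v = subst (_≤ K) (sym (count-column 𝒞⁺ (K * n) v fits)) (loads⁺ v)
  encodes : Encodes G c
  encodes u v u≢v = mk⇔ to from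
    where
    to : Adj G u v → Meet (c u) (c v)
    to a with covers u v a
    ... | C , C∈𝒞 , Cu , Cv with column-surjective 𝒞⁺ (K * n) fits (∈-filter⁺ inhabited? C∈𝒞 (u , Cu))
    ...   | i , refl = i , Cu , Cv
    from : Meet (c u) (c v) → Adj G u v
    from (i , cu , cv) =
      All.lookup cliques (proj₁ (∈-filter⁻ inhabited? (column-∈ 𝒞⁺ (K * n) i u cu))) u v cu cv u≢v

rowAt : ∀ N K → Fin (#subsets≤ N K) → Fin N → Bool
rowAt N       zero    _ = const false
rowAt zero    (suc K) _ = λ ()
rowAt (suc N) (suc K) i =
  [ (λ j → false Vec.∷ rowAt N (suc K) j) , (λ j → true Vec.∷ rowAt N K j) ]′ (splitAt (#subsets≤ N (suc K)) i)

rowAt-sparse : ∀ N K i → count (rowAt N K i) ≤ K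
rowAt-sparse N       zero    _ = ≤-reflexive (count-false N)
rowAt-sparse zero    (suc K) _ = z≤n
rowAt-sparse (suc N) (suc K) i with splitAt (#subsets≤ N (suc K)) i
... | inj₁ j = rowAt-sparse N (suc K) j
... | inj₂ j = s≤s (rowAt-sparse N K j)

rowAt-↑ˡ : ∀ N K i → rowAt (suc N) (suc K) (i ↑ˡ #subsets≤ N K) ≡ false Vec.∷ rowAt N (suc K) i
rowAt-↑ˡ N K i rewrite splitAt-↑ˡ (#subsets≤ N (suc K)) i (#subsets≤ N K) = refl

rowAt-↑ʳ : ∀ N K i → rowAt (suc N) (suc K) (#subsets≤ N (suc K) ↑ʳ i) ≡ true Vec.∷ rowAt N K i
rowAt-↑ʳ N K i rewrite splitAt-↑ʳ (#subsets≤ N (suc K)) (#subsets≤ N K) i = refl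

∷-≗ : ∀ {N b} {s : Fin N → Bool} (r : Fin (suc N) → Bool) →
      b ≡ r zero → (∀ j → s j ≡ r (suc j)) → ∀ j → (b Vec.∷ s) j ≡ r j
∷-≗ r b≡r₀ s≗r zero    = b≡r₀
∷-≗ r b≡r₀ s≗r (suc j) = s≗r j

rowAt-complete : ∀ N K (r : Fin N → Bool) → count r ≤ K → ∃ λ i → ∀ j → rowAt N K i j ≡ r j
rowAt-complete N       zero    r r≤0 = zero , λ j → sym (count≤0⇒false r r≤0 j)
rowAt-complete zero    (suc K) r _   = zero , λ ()
rowAt-complete (suc N) (suc K) r r≤K with r zero in r₀
... | false = let (i , eq) = rowAt-complete N (suc K) (r ∘ suc) r≤K in
  i ↑ˡ #subsets≤ N K , λ j → trans (cong (λ row → row j) (rowAt-↑ˡ N K i)) (∷-≗ r (sym r₀) eq j)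
... | true  = let (i , eq) = rowAt-complete N K (r ∘ suc) (s≤s⁻¹ r≤K) in
  #subsets≤ N (suc K) ↑ʳ i , λ j → trans (cong (λ row → row j) (rowAt-↑ʳ N K i)) (∷-≗ r (sym r₀) eq j)

codeAt : ∀ n N K → Fin (#subsets≤ N K ^ n) → Fin n → Fin N → Bool
codeAt n N K x v = rowAt N K (finToFun x v)

codeAt-sparse : ∀ n N K x → Sparse K (codeAt n N K x)
codeAt-sparse n N K x v = rowAt-sparse N K (finToFun x v)

codeAt-complete : ∀ {n N K} (c : Fin n → Fin N → Bool) → Sparse K c →
                  ∃ λ x → ∀ v i → codeAt n N K x v i ≡ c v i
codeAt-complete {n} {N} {K} c sparse = funToFin index , λ v i →
  trans (cong (λ j → rowAt N K j i) (finToFun-funToFin index v)) (proj₂ (rowAt-complete N K (c v) (sparse v)) i)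
  where
  index : Fin n → Fin (#subsets≤ N K)
  index v = proj₁ (rowAt-complete N K (c v) (sparse v))

hasCovering? : ∀ {n} (G : Graph n) K → Dec (HasKCliqueCovering G K)
hasCovering? {n} G K = map′
  (λ (x , enc) → encodes⇒covering G _ (codeAt-sparse n (K * n) K x) enc)
  (λ cov → let (c , sparse , enc) = covering⇒encodes G cov
               (x , x≗c) = codeAt-complete c sparse
           in x , Encodes-resp G (λ v i → sym (x≗c v i)) enc)
  (any? λ x → encodes? G (codeAt n (K * n) K x))

edge : ∀ {n} → Graph n → Fin n × Fin n → VSet n
edge G (x , y) w = adj G x y ∧ (⌊ w ≟ x ⌋ ∨ ⌊ w ≟ y ⌋)

edge-ends : ∀ {n} (G : Graph n) x y w → T (edge G (x , y) w) → Adj G x y × (w ≡ x ⊎ w ≡ y)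
edge-ends G x y w e with adj G x y | w ≟ x | w ≟ y
... | true | yes w≡x | _       = _ , inj₁ w≡x
... | true | no _    | yes w≡y = _ , inj₂ w≡y

edge-isClique : ∀ {n} (G : Graph n) xy → IsClique G (edge G xy)
edge-isClique G (x , y) u v eu ev u≢v with edge-ends G x y u eu | edge-ends G x y v ev
... | _  , inj₁ refl | _ , inj₁ refl = contradiction refl u≢v
... | xy , inj₁ refl | _ , inj₂ refl = xy
... | xy , inj₂ refl | _ , inj₁ refl = subst T (adj-sym G x y) xy
... | _  , inj₂ refl | _ , inj₂ refl = contradiction refl u≢v

edgeCovering : ∀ {n} (G : Graph n) → HasKCliqueCovering G (n * n)
edgeCovering {n} G = edges , (tabulate⁺ (edge-isClique G ∘ remQuot n) , covers) , loads
  where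
  edges = tabulate (edge G ∘ remQuot n)
  covers : ∀ u v → Adj G u v → ∃ λ C → C ∈ edges × T (C u) × T (C v)
  covers u v a = edge G (u , v)
               , subst (λ p → edge G p ∈ edges) (remQuot-combine u v) (∈-tabulate⁺ (combine u v))
               , Equivalence.from (T-∧ {adj G u v}) (a , Equivalence.from (T-∨ {⌊ u ≟ u ⌋}) (inj₁ (fromWitness refl)))
               , Equivalence.from (T-∧ {adj G u v}) (a , Equivalence.from (T-∨ {⌊ v ≟ u ⌋}) (inj₂ (fromWitness refl)))
  loads : ∀ v → load edges v ≤ n * n
  loads v = ≤-trans (length-filter (λ C → T? (C v)) edges) (≤-reflexive (length-tabulate (edge G ∘ remQuot n)))

least-witness : ∀ {P : ℕ → Set} → (∀ k → Dec (P k)) → ∀ b → P b → ∃ λ l → P l × (∀ k → P k → l ≤ k)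
least-witness         P? zero    Pb = zero , Pb , λ _ _ → z≤n
least-witness {P = P} P? (suc b) Pb with P? zero
... | yes P0 = zero , P0 , λ _ _ → z≤n
... | no ¬P0 = let (l , Pl , least) = least-witness {P = P ∘ suc} (P? ∘ suc) b Pb
               in suc l , Pl , λ { zero P0 → contradiction P0 ¬P0 ; (suc k) Pk → s≤s (least k Pk) }

lcc-exists : ∀ {n} (G : Graph n) → ∃ (IsLcc G)
lcc-exists G = least-witness (hasCovering? G) _ (edgeCovering G)

lcc-exceeds : ∀ {n} (G : Graph n) K → ¬ HasKCliqueCovering G K → ∃ λ l → IsLcc G l × K < l
lcc-exceeds G K ¬cover =
  let (l , isLcc) = lcc-exists G in l , isLcc , ≰⇒> λ l≤K → ¬cover (weaken l≤K (proj₁ isLcc))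
  where
  weaken : ∀ {j k} → j ≤ k → HasKCliqueCovering G j → HasKCliqueCovering G k
  weaken j≤k (𝒞 , covering , loads) = 𝒞 , covering , λ v → ≤-trans (loads v) j≤k

-- Cobipartite graphs without sparse coverings

↑ˡ≢↑ʳ : ∀ {m m′} (a : Fin m) (b : Fin m′) → a ↑ˡ m′ ≢ m ↑ʳ b
↑ˡ≢↑ʳ {m} {m′} a b eq with () ← trans (sym (splitAt-↑ˡ m a m′)) (trans (cong (splitAt m) eq) (splitAt-↑ʳ m m′ b))

module _ {m m′ : ℕ} (H : Fin m → Fin m′ → Bool) where

  private
    link : Fin m ⊎ Fin m′ → Fin m ⊎ Fin m′ → Bool
    link (inj₁ _) (inj₁ _) = true
    link (inj₂ _) (inj₂ _) = true
    link (inj₁ a) (inj₂ b) = H a b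
    link (inj₂ b) (inj₁ a) = H a b

    link-sym : ∀ s t → link s t ≡ link t s
    link-sym (inj₁ _) (inj₁ _) = refl
    link-sym (inj₂ _) (inj₂ _) = refl
    link-sym (inj₁ _) (inj₂ _) = refl
    link-sym (inj₂ _) (inj₁ _) = refl

    isLeft : Fin m ⊎ Fin m′ → Bool
    isLeft = [ const true , const false ]′

    link-sameSide : ∀ s t → isLeft s ≡ isLeft t → T (link s t)
    link-sameSide (inj₁ _) (inj₁ _) _ = _
    link-sameSide (inj₂ _) (inj₂ _) _ = _

  cobipartite : Graph (m + m′)
  cobipartite = record
    { adj   = λ u v → not (does (u ≟ v)) ∧ link (splitAt m u) (splitAt m v)
    ; sym   = λ u v → cong₂ (λ p q → not p ∧ q) (does-⇔ (mk⇔ sym sym) (u ≟ v) (v ≟ u)) (link-sym (splitAt m u) (splitAt m v))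
    ; irref = λ v → cong (λ p → not p ∧ link (splitAt m v) (splitAt m v)) (dec-true (v ≟ v) refl)
    }

  cobipartite-isCobipartite : IsCobipartite cobipartite
  cobipartite-isCobipartite = (λ u → isLeft (splitAt m u)) , λ u v u≢v ¬uv sameSide →
    ¬uv (Equivalence.from T-∧ (Equivalence.from T-not-≡ (dec-false (u ≟ v) u≢v) , link-sameSide (splitAt m u) (splitAt m v) sameSide))

  cobipartite-cross : ∀ a b → adj cobipartite (a ↑ˡ m′) (m ↑ʳ b) ≡ H a b
  cobipartite-cross a b
    rewrite dec-false (a ↑ˡ m′ ≟ m ↑ʳ b) (↑ˡ≢↑ʳ a b) | splitAt-↑ˡ m a m′ | splitAt-↑ʳ m m′ b = refl

<⇒∃-outside-image : ∀ {C D} (f : Fin C → Fin D) → C < D → ∃ λ y → ∀ x → f x ≢ y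
<⇒∃-outside-image {C} {D} f C<D with any? (λ y → all? λ x → ¬? (f x ≟ y))
... | yes outside = outside
... | no ¬outside = contradiction (injective⇒≤ section-injective) (<⇒≱ C<D)
  where
  preimage : ∀ y → ∃ λ x → f x ≡ y
  preimage y = decidable-stable (any? λ x → f x ≟ y) λ ¬pre → ¬outside (y , λ x fx≡y → ¬pre (x , fx≡y))
  section-injective : ∀ {y y′} → proj₁ (preimage y) ≡ proj₁ (preimage y′) → y ≡ y′
  section-injective {y} {y′} eq = trans (sym (proj₂ (preimage y))) (trans (cong f eq) (proj₂ (preimage y′)))

funToFin-cong : ∀ {k r} {f g : Fin k → Fin r} → (∀ i → f i ≡ g i) → funToFin f ≡ funToFin g
funToFin-cong {zero}  f≗g = refl
funToFin-cong {suc k} f≗g = cong₂ combine (f≗g zero) (funToFin-cong (f≗g ∘ suc))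

encodes⇒adj≡meet : ∀ {n N} (G : Graph n) {c : Fin n → Fin N → Bool} → Encodes G c →
                   ∀ {u v} → u ≢ v → adj G u v ≡ does (meet? (c u) (c v))
encodes⇒adj≡meet G {c} enc {u} {v} u≢v = does-⇔ (enc u v u≢v) (T? (adj G u v)) (meet? (c u) (c v))

-- Counting: there are fewer codes than cross patterns, so some pattern H is the cross
-- pattern of no code, and then cobipartite H has no K-clique covering.
∃-cobipartite-without-covering : ∀ m m′ K → #subsets≤ (K * (m + m′)) K ^ (m + m′) < 2 ^ (m * m′) →
  ∃ λ H → ¬ HasKCliqueCovering (cobipartite {m} {m′} H) K
∃-cobipartite-without-covering m m′ K fewCodes = H , no-covering
  where
  n = m + m′
  code = codeAt n (K * n) K
  crossPattern : Fin (#subsets≤ (K * n) K ^ n) → Fin (2 ^ (m * m′))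
  crossPattern y = funToFin λ p → let (a , b) = remQuot m′ p in
    Inverse.from 2↔Bool (does (meet? (code y (a ↑ˡ m′)) (code y (m ↑ʳ b))))
  missed = <⇒∃-outside-image crossPattern fewCodes
  H : Fin m → Fin m′ → Bool
  H a b = Inverse.to 2↔Bool (finToFun (proj₁ missed) (combine a b))
  no-covering : ¬ HasKCliqueCovering (cobipartite H) K
  no-covering cover = proj₂ missed y (trans (funToFin-cong pattern-y) (funToFin-finToFin {m * m′} {2} (proj₁ missed)))
    where
    G = cobipartite H
    encoding = covering⇒encodes G cover
    indexed = codeAt-complete (proj₁ encoding) (proj₁ (proj₂ encoding))
    y = proj₁ indexed
    encodes-y : Encodes G (code y)
    encodes-y = Encodes-resp G (λ v i → sym (proj₂ indexed v i)) (proj₂ (proj₂ encoding))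
    pattern-y : ∀ p → _ ≡ finToFun (proj₁ missed) p
    pattern-y p = let (a , b) = remQuot m′ p in begin
      Inverse.from 2↔Bool (does (meet? (code y (a ↑ˡ m′)) (code y (m ↑ʳ b))))
        ≡⟨ cong (Inverse.from 2↔Bool) (encodes⇒adj≡meet G encodes-y (↑ˡ≢↑ʳ a b)) ⟨
      Inverse.from 2↔Bool (adj G (a ↑ˡ m′) (m ↑ʳ b))
        ≡⟨ cong (Inverse.from 2↔Bool) (cobipartite-cross H a b) ⟩
      Inverse.from 2↔Bool (H a b)
        ≡⟨ Inverse.strictlyInverseʳ 2↔Bool (finToFun (proj₁ missed) (combine a b)) ⟩
      finToFun (proj₁ missed) (combine a b)
        ≡⟨ cong (finToFun (proj₁ missed)) (combine-remQuot {m} m′ p) ⟩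
      finToFun (proj₁ missed) p
        ∎
      where open ≡-Reasoning

-- Choosing the parameters

log₂-bracket : ∀ n → ∃ λ L → 2 ^ L ≤ suc n × suc n < 2 ^ suc L
log₂-bracket zero = 0 , s≤s z≤n , s≤s (s≤s z≤n)
log₂-bracket (suc n) with log₂-bracket n
... | L , lo , hi with suc (suc n) <? 2 ^ suc L
...   | yes below = L , m≤n⇒m≤1+n lo , below
...   | no ¬below = suc L , ≮⇒≥ ¬below , ≤-<-trans hi (^-monoʳ-< 2 (s≤s (s≤s z≤n)) (n<1+n (suc L)))

balanced-split : ∀ n → ∃₂ λ m m′ → n ≡ m + m′ × n * n ≤ 1 + 4 * (m * m′)
balanced-split 0 = 0 , 0 , refl , z≤n
balanced-split 1 = 0 , 1 , refl , ≤-refl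
balanced-split (suc (suc n)) with balanced-split n
... | m , m′ , refl , sq = suc m , suc m′ , cong suc (sym (+-suc m m′)) , (begin
  (2 + (m + m′)) * (2 + (m + m′))            ≡⟨ expand m m′ ⟩
  (m + m′) * (m + m′) + 4 * (1 + m + m′)     ≤⟨ +-monoˡ-≤ _ sq ⟩
  1 + 4 * (m * m′) + 4 * (1 + m + m′)        ≡⟨ collect m m′ ⟩
  1 + 4 * (suc m * suc m′)                   ∎)
  where
  open ≤-Reasoning
  expand : ∀ m m′ → (2 + (m + m′)) * (2 + (m + m′)) ≡ (m + m′) * (m + m′) + 4 * (1 + m + m′)
  expand = solve-∀
  collect : ∀ m m′ → 1 + 4 * (m * m′) + 4 * (1 + m + m′) ≡ 1 + 4 * (suc m * suc m′)
  collect = solve-∀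

n*n≤1+4M⇒0<M : ∀ {n M} → 2 ≤ n → n * n ≤ 1 + 4 * M → 0 < M
n*n≤1+4M⇒0<M {M = zero}  2≤n sq = contradiction (≤-trans (*-mono-≤ 2≤n 2≤n) sq) λ { (s≤s ()) }
n*n≤1+4M⇒0<M {M = suc M} _   _  = s≤s z≤n

4xt+4t≤1+4M⇒xt<M : ∀ x t M → 4 * (x * t) + 4 * t ≤ 1 + 4 * M → 0 < M → x * t < M
4xt+4t≤1+4M⇒xt<M x zero    M _  0<M rewrite *-zeroʳ x = 0<M
4xt+4t≤1+4M⇒xt<M x (suc t) M le _   = *-cancelˡ-< 4 (x * suc t) M (s≤s⁻¹ (begin
  2 + 4 * (x * suc t)          ≤⟨ +-monoˡ-≤ _ (≤-trans (s≤s (s≤s z≤n)) (m≤m*n 4 (suc t))) ⟩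
  4 * suc t + 4 * (x * suc t)  ≡⟨ +-comm (4 * suc t) _ ⟩
  4 * (x * suc t) + 4 * suc t  ≤⟨ le ⟩
  1 + 4 * M                    ∎))
  where open ≤-Reasoning

fewer-codes-than-patterns : ∀ {n L K M} → 2 ≤ n → suc n ≤ 2 ^ suc L → K * (4 * (4 + L)) ≤ n →
                            n * n ≤ 1 + 4 * M → #subsets≤ (K * n) K ^ n < 2 ^ M
fewer-codes-than-patterns {n} {L} {K} {M} 2≤n n<2^[1+L] K≤ sq = begin-strict
  #subsets≤ (K * n) K ^ n        ≤⟨ ^-monoˡ-≤ n (#subsets≤-bound K n) ⟩
  ((4 * suc n) ^ K) ^ n          ≤⟨ ^-monoˡ-≤ n (^-monoˡ-≤ K 4[1+n]≤) ⟩
  ((2 ^ (3 + L)) ^ K) ^ n        ≡⟨ trans (cong (_^ n) (^-*-assoc 2 (3 + L) K)) (^-*-assoc 2 ((3 + L) * K) n) ⟩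
  2 ^ ((3 + L) * K * n)          ≡⟨ cong (2 ^_) (*-assoc (3 + L) K n) ⟩
  2 ^ ((3 + L) * (K * n))        <⟨ ^-monoʳ-< 2 (s≤s (s≤s z≤n)) exponent< ⟩
  2 ^ M                          ∎
  where
  open ≤-Reasoning
  4[1+n]≤ : 4 * suc n ≤ 2 ^ (3 + L)
  4[1+n]≤ = ≤-trans (*-monoʳ-≤ 4 n<2^[1+L]) (≤-reflexive (*-assoc 2 2 (2 ^ suc L)))
  exponent< : (3 + L) * (K * n) < M
  exponent< = 4xt+4t≤1+4M⇒xt<M (3 + L) (K * n) M (begin
    4 * ((3 + L) * (K * n)) + 4 * (K * n)  ≡⟨ regroup L K n ⟩
    K * (4 * (4 + L)) * n                  ≤⟨ *-monoˡ-≤ n K≤ ⟩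
    n * n                                  ≤⟨ sq ⟩
    1 + 4 * M                              ∎) (n*n≤1+4M⇒0<M 2≤n sq)
    where
    regroup : ∀ L K n → 4 * ((3 + L) * (K * n)) + 4 * (K * n) ≡ K * (4 * (4 + L)) * n
    regroup = solve-∀

-- With e = 1 / (1 + d), LccBound asks for 2 ^ (d n) < n ^ (4 (1 + d) l).
lcc-bound-numeric : ∀ {n L l d} → 2 ≤ n → 2 ^ L ≤ n → n < l * (4 * (4 + L)) → d * 4 ≤ L →
                    2 ^ (d * n) < n ^ (4 * suc d * l)
lcc-bound-numeric {l = zero} _ _ ()
lcc-bound-numeric {n} {L} {suc l} {zero}  2≤n _ _ _ = ^-monoʳ-< n 2≤n {0} {4 * 1 * suc l} (s≤s z≤n)
lcc-bound-numeric {n} {L} {l} {d@(suc _)} 2≤n 2^L≤n n<lD 4d≤L = begin-strict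
  2 ^ (d * n)                 <⟨ ^-monoʳ-< 2 (s≤s (s≤s z≤n)) dn<LE ⟩
  2 ^ (L * (4 * suc d * l))   ≡⟨ ^-*-assoc 2 L _ ⟨
  (2 ^ L) ^ (4 * suc d * l)   ≤⟨ ^-monoˡ-≤ (4 * suc d * l) 2^L≤n ⟩
  n ^ (4 * suc d * l)         ∎
  where
  open ≤-Reasoning
  dn<LE : d * n < L * (4 * suc d * l)
  dn<LE = begin-strict
    d * n                                  <⟨ *-monoʳ-< d n<lD ⟩
    d * (l * (4 * (4 + L)))                ≡⟨ expand d l L ⟩
    4 * l * (d * L) + 4 * l * (d * 4)      ≤⟨ +-monoʳ-≤ _ (*-monoʳ-≤ (4 * l) 4d≤L) ⟩
    4 * l * (d * L) + 4 * l * L            ≡⟨ collect d l L ⟩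
    L * (4 * suc d * l)                    ∎
    where
    expand : ∀ d l L → d * (l * (4 * (4 + L))) ≡ 4 * l * (d * L) + 4 * l * (d * 4)
    expand = solve-∀
    collect : ∀ d l L → 4 * l * (d * L) + 4 * l * L ≡ L * (4 * suc d * l)
    collect = solve-∀

n<[1+n/d]*d : ∀ n d .{{_ : NonZero d}} → n < suc (n / d) * d
n<[1+n/d]*d n d = begin-strict
  n                  ≡⟨ m≡m%n+[m/n]*n n d ⟩
  n % d + n / d * d  <⟨ +-monoˡ-< (n / d * d) (m%n<n n d) ⟩
  d + n / d * d      ∎
  where open ≤-Reasoning

-- K = ⌊n / 4(4 + L)⌋, where 2^L ≤ n < 2^(L+1), is small enough for fewer-codes-than-patterns.
cobipartite-with-large-lcc : ∀ n L → 2 ≤ n → 2 ^ L ≤ n → suc n ≤ 2 ^ suc L →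
  Σ (Graph n) λ G → IsCobipartite G × ∃ λ l → IsLcc G l × 2 ^ (L / 4 * n) < n ^ (4 * suc (L / 4) * l)
cobipartite-with-large-lcc n L 2≤n 2^L≤n n<2^[1+L] with balanced-split n
... | m , m′ , refl , sq = cobipartite H , cobipartite-isCobipartite H , l , isLcc ,
  lcc-bound-numeric {l = l} {d = L / 4} 2≤n 2^L≤n (<-≤-trans (n<[1+n/d]*d n D) (*-monoˡ-≤ D K<l)) (m/n*n≤m L 4)
  where
  D = 4 * (4 + L)
  K = n / D
  missing = ∃-cobipartite-without-covering m m′ K
    (fewer-codes-than-patterns {L = L} {K} {m * m′} 2≤n n<2^[1+L] (m/n*n≤m n D) sq)
  H = proj₁ missing
  exceeds = lcc-exceeds (cobipartite H) K (proj₂ missing)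
  l = proj₁ exceeds
  isLcc = proj₁ (proj₂ exceeds)
  K<l = proj₂ (proj₂ exceeds)

-- ε n = 1 / (1 + ⌊⌊log₂ n⌋ / 4⌋) for n ≥ 2; ε 1 = 2 > 1 makes LccBound 1 l (ε 1) vacuous.
ε : ℕ → ℚ
ε (suc (suc k))   = mkℚ (ℤ.+ 1) (proj₁ (log₂-bracket (suc k)) / 4) (1-coprimeTo _)
ε _               = ℤ.+ 2 ℚ./ 1

ε→0 : TendsToZero ε
ε→0 (mkℚ (ℤ.+ zero)  _ _) (ℚ.*<* (ℤ.+<+ ()))
ε→0 (mkℚ ℤ.-[1+ _ ]  _ _) (ℚ.*<* ())
ε→0 δ@(mkℚ (ℤ.+ suc p) q _) _ = 2 ^ (4 * suc q) , small
  where
  2≤N : 2 ≤ 2 ^ (4 * suc q)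
  2≤N = *-monoʳ-≤ 2 (m^n>0 2 (q + 3 * suc q))
  small : ∀ n → 2 ^ (4 * suc q) ≤ n → ℚ.∣ ε n ∣ ℚ.< δ
  small 0 N≤n = contradiction (≤-trans 2≤N N≤n) λ ()
  small 1 N≤n = contradiction (≤-trans 2≤N N≤n) λ { (s≤s ()) }
  small (suc (suc k)) N≤n with log₂-bracket (suc k)
  ... | L , _ , n<2^[1+L] = ℚ.*<* (ℤ.+<+ (begin-strict
    1 * suc q          ≡⟨ *-identityˡ (suc q) ⟩
    suc q              ≡⟨ m*n/n≡m (suc q) 4 ⟨
    suc q * 4 / 4      ≤⟨ /-monoˡ-≤ 4 (≤-trans (≤-reflexive (*-comm (suc q) 4)) (s≤s⁻¹ 4[1+q]<1+L)) ⟩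
    L / 4              <⟨ n<1+n (L / 4) ⟩
    suc (L / 4)        ≤⟨ m≤n*m (suc (L / 4)) (suc p) ⟩
    suc p * suc (L / 4) ∎))
    where
    open ≤-Reasoning
    4[1+q]<1+L : 4 * suc q < suc L
    4[1+q]<1+L = ≰⇒> λ 1+L≤ → <-irrefl refl (<-≤-trans n<2^[1+L] (≤-trans (^-monoʳ-≤ 2 1+L≤) N≤n))

theorem1 : Σ (ℕ → ℚ) λ ε → TendsToZero ε ×
    (∀ (n : ℕ) → 1 ≤ n →
      Σ (Graph n) λ G → IsCobipartite G × ∃ λ l → IsLcc G l × LccBound n l (ε n))
theorem1 = ε , ε→0 , lower-bound
  where
  lower-bound : ∀ n → 1 ≤ n → Σ (Graph n) λ G → IsCobipartite G × ∃ λ l → IsLcc G l × LccBound n l (ε n)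
  lower-bound 1 _ = cobipartite none , cobipartite-isCobipartite none
                  , proj₁ (lcc-exists (cobipartite none)) , proj₂ (lcc-exists (cobipartite none)) , tt
    where
    none : Fin 1 → Fin 0 → Bool
    none _ ()
  lower-bound n@(suc (suc k)) _ with log₂-bracket (suc k)
  ... | L , 2^L≤n , n<2^[1+L] = cobipartite-with-large-lcc n L (s≤s (s≤s z≤n)) 2^L≤n n<2^[1+L]
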